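{- Let $n\ge 3$ and $\pi\in\Pi(n)$. Let $A\subseteq S_{\mathrm{out}}(\pi)$ be any set with $|A| = 2^{n-1}+1$. Then $\pi$ is the unique $\sigma\in\Pi(n)$ with $A\subseteq S_{\mathrm{out}}(\sigma)$.
   Context: $\Pi(n)$ denotes the set of permutations of $\{1,\dots,n\}$, each regarded as a sequence $\pi=(\pi_1,\dots,\pi_n)$. A TDRL operation on $\pi$ is specified by a binary pattern $b\in\{0,1\}^n$. Its result is the concatenation of the subsequence $(\pi_i : b_i=1)$ with the subsequence $(\pi_i : b_i=0)$, each taken with indices in increasing order. $S_{\mathrm{out}}(\pi)$ is the set of all sequences obtainable from $\pi$ by one TDRL operation. -}

module Defs where

open import Data.Nat using (ℕ)
open import Data.Bool using (Bool; true; false; not)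
open import Data.Fin using (Fin)
open import Data.Vec using (Vec; []; _∷_; lookup)
open import Data.List using (List; []; _∷_; _++_)
open import Data.Product using (∃)
open import Relation.Binary.PropositionalEquality using (_≡_)
open import Function.Definitions using (Injective)

-- A sequence of length n with entries in Fin n (values 0..n-1 stand for 1..n).
-- It is a permutation of {1..n} iff it is injective (hence bijective).
IsPerm : ∀ {n} → Vec (Fin n) n → Set
IsPerm {n} π = Injective _≡_ _≡_ (lookup π)

select : ∀ {A : Set} {n} → Bool → Vec Bool n → Vec A n → List A
select c [] [] = []
select c (true ∷ b) (x ∷ xs) with c
... | true  = x ∷ select c b xs
... | false = select c b xs
select c (false ∷ b) (x ∷ xs) with c
... | true  = select c b xs
... | false = x ∷ select c b xs

tdrl : ∀ {A : Set} {n} → Vec Bool n → Vec A n → List A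
tdrl b π = select true b π ++ select false b π

InSout : ∀ {n} → List (Fin n) → Vec (Fin n) n → Set
InSout τ π = ∃ λ b → tdrl b π ≡ τ

module Submission where

-- Let π ≠ σ be permutations of length n ≥ 2 and let k be the
-- first position where they differ, x = π_k and y = σ_k.  Since π and σ agree
-- before k, the entry y occurs in π at some position q > k and x occurs in σ at
-- some position s > k.  A TDRL with pattern b keeps the relative order of the
-- entries at positions i < j unless b_i = 0 and b_j = 1 ("b inverts i, j").
-- A common output τ of π and σ has no repeated entries, so it cannot put x both
-- before and after y: either π's pattern inverts (k, q) or σ's pattern inverts
-- (k, s).  Each of these two families has 2^(n-2) patterns, so a duplicate-free
-- list of common outputs has at most 2^(n-1) members (commonOutputs-bound).

open import Defs
open import Data.Bool using (Bool; true; false)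
open import Data.Empty using (⊥; ⊥-elim)
open import Data.Fin as Fin using (Fin; zero; suc; _≟_; punchOut)
import Data.Fin.Properties as FinP
open import Data.List using (List; []; _∷_; _++_; length; map)
open import Data.List.Membership.Propositional using (_∈_; _∉_)
open import Data.List.Membership.Propositional.Properties
  using (∈-++⁺ˡ; ∈-++⁺ʳ; ∈-++⁻; ∈-∃++; ∈-map⁺)
open import Data.List.Properties using (length-++; length-map; ++-assoc; ∷-injective)
open import Data.List.Relation.Binary.Subset.Propositional using (_⊆_)
open import Data.List.Relation.Unary.All as All using (All)
open import Data.List.Relation.Unary.All.Properties using (¬Any⇒All¬)
open import Data.List.Relation.Unary.AllPairs using ([]; _∷_)
import Data.List.Relation.Unary.AllPairs.Properties as AllPairs
open import Data.List.Relation.Unary.Any using (here; there)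
open import Data.List.Relation.Unary.Unique.Propositional using (Unique)
open import Data.Nat using (ℕ; zero; suc; _≤_; _+_; _^_; _∸_; z≤n; s≤s)
import Data.Nat.Properties as ℕP
open import Data.Product using (∃; ∃₂; _×_; _,_; proj₁; proj₂)
open import Data.Sum using (_⊎_; inj₁; inj₂)
open import Data.Vec using (Vec; []; _∷_; lookup; insertAt; removeAt)
import Data.Vec.Properties as VecP
open import Function.Base using (_∘′_)
open import Function.Definitions using (Injective)
open import Relation.Binary.Definitions using (tri<; tri≈; tri>)
open import Relation.Binary.PropositionalEquality
  using (_≡_; _≢_; refl; sym; trans; cong; cong₂; subst; module ≡-Reasoning)
open import Relation.Nullary using (yes; no; contradiction)

private
  variable
    X : Set
    m n : ℕ

InjectiveSeq : Vec X n → Set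
InjectiveSeq π = Injective _≡_ _≡_ (lookup π)

select-∈ : ∀ c (b : Vec Bool n) (π : Vec X n) i →
  lookup b i ≡ c → lookup π i ∈ select c b π
select-∈ true  (true  ∷ b) (x ∷ π) zero    refl = here refl
select-∈ false (false ∷ b) (x ∷ π) zero    refl = here refl
select-∈ true  (true  ∷ b) (x ∷ π) (suc i) bit  = there (select-∈ true b π i bit)
select-∈ true  (false ∷ b) (x ∷ π) (suc i) bit  = select-∈ true b π i bit
select-∈ false (true  ∷ b) (x ∷ π) (suc i) bit  = select-∈ false b π i bit
select-∈ false (false ∷ b) (x ∷ π) (suc i) bit  = there (select-∈ false b π i bit)

select-∈⁻ : ∀ c (b : Vec Bool n) (π : Vec X n) {z} →
  z ∈ select c b π → ∃ λ i → lookup π i ≡ z × lookup b i ≡ c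
select-∈⁻ c     []          []      ()
select-∈⁻ true  (true  ∷ b) (x ∷ π) (here refl) = zero , refl , refl
select-∈⁻ false (false ∷ b) (x ∷ π) (here refl) = zero , refl , refl
select-∈⁻ true  (true  ∷ b) (x ∷ π) (there z∈)
  with i , πi≡z , bit ← select-∈⁻ true b π z∈ = suc i , πi≡z , bit
select-∈⁻ true  (false ∷ b) (x ∷ π) z∈
  with i , πi≡z , bit ← select-∈⁻ true b π z∈ = suc i , πi≡z , bit
select-∈⁻ false (true  ∷ b) (x ∷ π) z∈
  with i , πi≡z , bit ← select-∈⁻ false b π z∈ = suc i , πi≡z , bit
select-∈⁻ false (false ∷ b) (x ∷ π) (there z∈)
  with i , πi≡z , bit ← select-∈⁻ false b π z∈ = suc i , πi≡z , bit

Before : X → X → List X → Set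
Before x y τ = ∃₂ λ P Q → τ ≡ P ++ x ∷ Q × y ∈ Q

Before-∷ : ∀ {x y τ} z → Before {X} x y τ → Before x y (z ∷ τ)
Before-∷ z (P , Q , refl , y∈Q) = z ∷ P , Q , refl , y∈Q

Before-++ˡ : ∀ {x y} L M → Before {X} x y L → Before x y (L ++ M)
Before-++ˡ {x = x} L M (P , Q , refl , y∈Q) = P , Q ++ M , ++-assoc P (x ∷ Q) M , ∈-++⁺ˡ y∈Q

Before-++ʳ : ∀ {x y} L M → Before {X} x y M → Before x y (L ++ M)
Before-++ʳ {x = x} L M (P , Q , refl , y∈Q) = L ++ P , Q , sym (++-assoc L P (x ∷ Q)) , y∈Q

Before-across : ∀ {x y} L M → x ∈ L → y ∈ M → Before {X} x y (L ++ M)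
Before-across {x = x} L M x∈L y∈M with P , Q , refl ← ∈-∃++ x∈L =
  P , Q ++ M , ++-assoc P (x ∷ Q) M , ∈-++⁺ʳ Q y∈M

Before-asym : ∀ {x y : X} {τ} → Unique τ → x ≢ y → Before x y τ → Before y x τ → ⊥
Before-asym {x = x} {y} u x≢y (P , Q , refl , y∈Q) (P′ , Q′ , same , x∈Q′) = go P P′ u same
  where
  go : ∀ P P′ → Unique (P ++ x ∷ Q) → P ++ x ∷ Q ≡ P′ ++ y ∷ Q′ → ⊥
  go []      []       _        same = x≢y (proj₁ (∷-injective same))
  go []      (p ∷ P′) (x∉ ∷ _) same =
    All.lookup x∉ (subst (x ∈_) (sym (proj₂ (∷-injective same))) (∈-++⁺ʳ P′ (there x∈Q′))) refl
  go (p ∷ P) []       (p∉ ∷ _) same = All.lookup p∉ (∈-++⁺ʳ P (there y∈Q)) (proj₁ (∷-injective same))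
  go (p ∷ P) (_ ∷ P′) (_ ∷ u)  same = go P P′ u (proj₂ (∷-injective same))

select-Before : ∀ c (b : Vec Bool n) (π : Vec X n) {i j} → i Fin.< j →
  lookup b i ≡ c → lookup b j ≡ c → Before (lookup π i) (lookup π j) (select c b π)
select-Before true  (true  ∷ b) (x ∷ π) {zero} {suc j} _ refl bj =
  [] , _ , refl , select-∈ true b π j bj
select-Before false (false ∷ b) (x ∷ π) {zero} {suc j} _ refl bj =
  [] , _ , refl , select-∈ false b π j bj
select-Before true  (true  ∷ b) (x ∷ π) {suc i} {suc j} (s≤s i<j) bi bj =
  Before-∷ x (select-Before true b π i<j bi bj)
select-Before true  (false ∷ b) (x ∷ π) {suc i} {suc j} (s≤s i<j) bi bj =
  select-Before true b π i<j bi bj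
select-Before false (true  ∷ b) (x ∷ π) {suc i} {suc j} (s≤s i<j) bi bj =
  select-Before false b π i<j bi bj
select-Before false (false ∷ b) (x ∷ π) {suc i} {suc j} (s≤s i<j) bi bj =
  Before-∷ x (select-Before false b π i<j bi bj)

Inverts : Vec Bool n → Fin n → Fin n → Set
Inverts b i j = lookup b i ≡ false × lookup b j ≡ true

tdrl-order : ∀ (b : Vec Bool n) (π : Vec X n) {i j} → i Fin.< j →
  Inverts b i j ⊎ Before (lookup π i) (lookup π j) (tdrl b π)
tdrl-order b π {i} {j} i<j with lookup b i in bi | lookup b j in bj
... | true  | true  = inj₂ (Before-++ˡ (select true b π) _ (select-Before true b π i<j bi bj))
... | false | false = inj₂ (Before-++ʳ (select true b π) _ (select-Before false b π i<j bi bj))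
... | true  | false =
  inj₂ (Before-across (select true b π) _ (select-∈ true b π i bi) (select-∈ false b π j bj))
... | false | true  = inj₁ (refl , refl)

select-∉ : ∀ c (b : Vec Bool n) (π : Vec X n) {x} → (∀ i → lookup π i ≢ x) → x ∉ select c b π
select-∉ c b π notIn x∈ with i , πi≡x , _ ← select-∈⁻ c b π x∈ = notIn i πi≡x

head-fresh : ∀ c (b : Vec Bool n) x (π : Vec X n) → InjectiveSeq (x ∷ π) → All (x ≢_) (select c b π)
head-fresh c b x π inj = ¬Any⇒All¬ _ (select-∉ c b π λ i πi≡x → FinP.0≢1+n (inj (sym πi≡x)))

InjectiveSeq-tail : ∀ {x} {π : Vec X n} → InjectiveSeq (x ∷ π) → InjectiveSeq π
InjectiveSeq-tail inj = FinP.suc-injective ∘′ inj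

select-unique : ∀ c (b : Vec Bool n) (π : Vec X n) → InjectiveSeq π → Unique (select c b π)
select-unique c     []          []      _   = []
select-unique true  (true  ∷ b) (x ∷ π) inj =
  head-fresh true b x π inj ∷ select-unique true b π (InjectiveSeq-tail inj)
select-unique true  (false ∷ b) (x ∷ π) inj = select-unique true b π (InjectiveSeq-tail inj)
select-unique false (true  ∷ b) (x ∷ π) inj = select-unique false b π (InjectiveSeq-tail inj)
select-unique false (false ∷ b) (x ∷ π) inj =
  head-fresh false b x π inj ∷ select-unique false b π (InjectiveSeq-tail inj)

-- The two blocks of an output of an injective sequence share no entry, since an
-- entry determines its position and a position carries only one bit.
tdrl-unique : ∀ (b : Vec Bool n) (π : Vec X n) → InjectiveSeq π → Unique (tdrl b π)
tdrl-unique b π inj = AllPairs.++⁺ (select-unique true b π inj) (select-unique false b π inj)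
  (All.tabulate λ z∈ → All.tabulate λ w∈ → blocks-disjoint z∈ w∈)
  where
  blocks-disjoint : ∀ {z w} → z ∈ select true b π → w ∈ select false b π → z ≢ w
  blocks-disjoint z∈ w∈ refl
    with i , πi≡z , bi ← select-∈⁻ true b π z∈ | j , πj≡z , bj ← select-∈⁻ false b π w∈
    with refl ← inj (trans πi≡z (sym πj≡z)) with () ← trans (sym bi) bj

Unique-⊆-length : ∀ (xs ys : List X) → Unique xs → xs ⊆ ys → length xs ≤ length ys
Unique-⊆-length []       ys _           _  = z≤n
Unique-⊆-length (x ∷ xs) ys (x∉ ∷ uxs) xs⊆ys with Y₁ , Y₂ , refl ← ∈-∃++ (xs⊆ys (here refl)) =
  subst (suc (length xs) ≤_) (sym (length-around Y₁ Y₂))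
    (s≤s (subst (length xs ≤_) (length-++ Y₁) (Unique-⊆-length xs (Y₁ ++ Y₂) uxs rest⊆)))
  where
  length-around : ∀ Y₁ Y₂ → length (Y₁ ++ x ∷ Y₂) ≡ suc (length Y₁ + length Y₂)
  length-around Y₁ Y₂ = trans (length-++ Y₁) (ℕP.+-suc (length Y₁) (length Y₂))

  rest⊆ : xs ⊆ Y₁ ++ Y₂
  rest⊆ z∈ with ∈-++⁻ Y₁ (xs⊆ys (there z∈))
  ... | inj₁ z∈Y₁          = ∈-++⁺ˡ z∈Y₁
  ... | inj₂ (here refl)   = ⊥-elim (All.lookup x∉ z∈ refl)
  ... | inj₂ (there z∈Y₂)  = ∈-++⁺ʳ Y₁ z∈Y₂

allPatterns : ∀ m → List (Vec Bool m)
allPatterns zero    = [] ∷ []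
allPatterns (suc m) = map (true ∷_) (allPatterns m) ++ map (false ∷_) (allPatterns m)

allPatterns-length : ∀ m → length (allPatterns m) ≡ 2 ^ m
allPatterns-length zero    = refl
allPatterns-length (suc m) = begin
  length (map (true ∷_) P ++ map (false ∷_) P)        ≡⟨ length-++ (map (true ∷_) P) ⟩
  length (map (true ∷_) P) + length (map (false ∷_) P) ≡⟨ cong₂ _+_ (length-map _ P) (length-map _ P) ⟩
  length P + length P                                   ≡⟨ cong (λ l → l + l) (allPatterns-length m) ⟩
  2 ^ m + 2 ^ m                                         ≡⟨ cong (2 ^ m +_) (sym (ℕP.+-identityʳ (2 ^ m))) ⟩
  2 ^ suc m                                             ∎
  where
  open ≡-Reasoning
  P : List (Vec Bool m)
  P = allPatterns m

allPatterns-complete : ∀ (b : Vec Bool m) → b ∈ allPatterns m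
allPatterns-complete []          = here refl
allPatterns-complete (true ∷ b)  = ∈-++⁺ˡ (∈-map⁺ (true ∷_) (allPatterns-complete b))
allPatterns-complete (false ∷ b) =
  ∈-++⁺ʳ (map (true ∷_) (allPatterns _)) (∈-map⁺ (false ∷_) (allPatterns-complete b))

withEntry : Fin (suc n) → X → List (Vec X n) → List (Vec X (suc n))
withEntry p v = map (λ d → insertAt d p v)

withEntry-complete : ∀ {p : Fin (suc n)} {v : X} {L} (b : Vec X (suc n)) →
  lookup b p ≡ v → removeAt b p ∈ L → b ∈ withEntry p v L
withEntry-complete {p = p} {L = L} b refl rest∈L =
  subst (_∈ withEntry p (lookup b p) L) (VecP.insertAt-removeAt b p)
    (∈-map⁺ (λ d → insertAt d p (lookup b p)) rest∈L)

inverting : (i j : Fin (suc (suc m))) → i ≢ j → List (Vec Bool (suc (suc m)))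
inverting {m} i j i≢j = withEntry i false (withEntry (punchOut i≢j) true (allPatterns m))

inverting-length : ∀ (i j : Fin (suc (suc m))) (i≢j : i ≢ j) →
  length (inverting i j i≢j) ≡ 2 ^ m
inverting-length {m} i j i≢j =
  trans (length-map _ (withEntry (punchOut i≢j) true (allPatterns m)))
    (trans (length-map _ (allPatterns m)) (allPatterns-length m))

inverting-complete : ∀ {i j : Fin (suc (suc m))} (i≢j : i ≢ j) (b : Vec Bool (suc (suc m))) →
  Inverts b i j → b ∈ inverting i j i≢j
inverting-complete {i = i} i≢j b (bi , bj) = withEntry-complete b bi
  (withEntry-complete (removeAt b i) (trans (VecP.removeAt-punchOut b i≢j) bj)
    (allPatterns-complete _))

-- An injective map Fin n → Fin n is onto: a missed value y would let punchOut y
-- inject Fin n into Fin (n - 1).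
injective⇒onto : ∀ {f : Fin n → Fin n} → Injective _≡_ _≡_ f → ∀ y → ∃ λ i → f i ≡ y
injective⇒onto {zero}      _   ()
injective⇒onto {suc n} {f} inj y with FinP.any? (λ i → f i ≟ y)
... | yes hit  = hit
... | no  miss = contradiction (FinP.injective⇒≤ punched-injective) ℕP.1+n≰n
  where
  avoided : ∀ i → y ≢ f i
  avoided i y≡fi = miss (i , sym y≡fi)

  punched-injective : Injective _≡_ _≡_ (λ i → punchOut (avoided i))
  punched-injective same = inj (FinP.punchOut-injective (avoided _) (avoided _) same)

firstDifference : ∀ {N} (σ π : Vec (Fin N) n) → σ ≢ π →
  ∃ λ k → lookup σ k ≢ lookup π k × (∀ i → i Fin.< k → lookup σ i ≡ lookup π i)
firstDifference []      []      σ≢π = ⊥-elim (σ≢π refl)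
firstDifference (a ∷ σ) (b ∷ π) σ≢π with a ≟ b
... | no  a≢b  = zero , a≢b , λ _ ()
... | yes refl with k , differ , agree ← firstDifference σ π (σ≢π ∘′ cong (a ∷_)) =
  suc k , differ , λ where
    zero    _         → refl
    (suc i) (s≤s i<k) → agree i i<k

occursAfter : ∀ (σ π : Vec X n) {k q} → InjectiveSeq σ →
  (∀ i → i Fin.< k → lookup σ i ≡ lookup π i) → lookup σ k ≢ lookup π k →
  lookup π q ≡ lookup σ k → k Fin.< q
occursAfter σ π {k} {q} σinj agree differ πq≡σk with FinP.<-cmp k q
... | tri< k<q _ _ = k<q
... | tri≈ _ refl _ = contradiction (sym πq≡σk) differ
... | tri> _ _ q<k = contradiction (σinj (trans (agree q q<k) πq≡σk)) (FinP.<⇒≢ q<k)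

-- A common output of π and σ cannot place π_k both before and after π_q, so
-- either π's pattern inverts (k, q) or σ's pattern inverts (k, s).
commonOutput-split : ∀ (π σ : Vec X n) → InjectiveSeq π → ∀ {k q s} →
  k Fin.< q → k Fin.< s → lookup π q ≡ lookup σ k → lookup σ s ≡ lookup π k →
  ∀ b c → tdrl b π ≡ tdrl c σ → Inverts b k q ⊎ Inverts c k s
commonOutput-split π σ πinj k<q k<s πq≡σk σs≡πk b c same
  with tdrl-order b π k<q | tdrl-order c σ k<s
... | inj₁ inverts | _           = inj₁ inverts
... | inj₂ _       | inj₁ inverts = inj₂ inverts
... | inj₂ πk-before-πq | inj₂ σk-before-σs =
  ⊥-elim (Before-asym (tdrl-unique b π πinj) (FinP.<⇒≢ k<q ∘′ πinj) πk-before-πq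
    (subst₃ Before (sym πq≡σk) σs≡πk (sym same) σk-before-σs))
  where
  subst₃ : ∀ (R : X → X → List X → Set) {x x′ y y′ τ τ′} →
    x ≡ x′ → y ≡ y′ → τ ≡ τ′ → R x y τ → R x′ y′ τ′
  subst₃ R refl refl refl r = r

invertedOutputs : Vec X (suc (suc m)) → (i j : Fin (suc (suc m))) → i ≢ j → List (List X)
invertedOutputs π i j i≢j = map (λ b → tdrl b π) (inverting i j i≢j)

invertedOutputs-length : ∀ (π : Vec X (suc (suc m))) i j (i≢j : i ≢ j) →
  length (invertedOutputs π i j i≢j) ≡ 2 ^ m
invertedOutputs-length π i j i≢j =
  trans (length-map (λ b → tdrl b π) (inverting i j i≢j)) (inverting-length i j i≢j)

invertedOutputs-complete : ∀ (π : Vec X (suc (suc m))) {i j} (i≢j : i ≢ j) b →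
  Inverts b i j → tdrl b π ∈ invertedOutputs π i j i≢j
invertedOutputs-complete π i≢j b inverts =
  ∈-map⁺ (λ b → tdrl b π) (inverting-complete i≢j b inverts)

commonOutputs-bound-at : ∀ (π σ : Vec X (suc (suc m))) → InjectiveSeq π → ∀ {k q s} →
  k Fin.< q → k Fin.< s → lookup π q ≡ lookup σ k → lookup σ s ≡ lookup π k →
  (A : List (List X)) → Unique A →
  (∀ τ → τ ∈ A → ∃ λ b → tdrl b π ≡ τ) → (∀ τ → τ ∈ A → ∃ λ c → tdrl c σ ≡ τ) →
  length A ≤ 2 ^ suc m
commonOutputs-bound-at {X = X} {m = m} π σ πinj {k} {q} {s} k<q k<s πq≡σk σs≡πk A uniqueA fromπ fromσ =
  subst (length A ≤_) candidates-length (Unique-⊆-length A (outputsπ ++ outputsσ) uniqueA covered)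
  where
  k≢q : k ≢ q
  k≢q = FinP.<⇒≢ k<q
  k≢s : k ≢ s
  k≢s = FinP.<⇒≢ k<s

  outputsπ outputsσ : List (List X)
  outputsπ = invertedOutputs π k q k≢q
  outputsσ = invertedOutputs σ k s k≢s

  covered : A ⊆ outputsπ ++ outputsσ
  covered {τ} τ∈A with fromπ τ τ∈A | fromσ τ τ∈A
  ... | b , refl | c , same with commonOutput-split π σ πinj k<q k<s πq≡σk σs≡πk b c (sym same)
  ... | inj₁ inverts = ∈-++⁺ˡ (invertedOutputs-complete π k≢q b inverts)
  ... | inj₂ inverts =
    ∈-++⁺ʳ outputsπ (subst (_∈ outputsσ) same (invertedOutputs-complete σ k≢s c inverts))

  candidates-length : length (outputsπ ++ outputsσ) ≡ 2 ^ suc m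
  candidates-length = begin
    length (outputsπ ++ outputsσ)     ≡⟨ length-++ outputsπ ⟩
    length outputsπ + length outputsσ ≡⟨ cong₂ _+_ (invertedOutputs-length π k q k≢q)
                                                   (invertedOutputs-length σ k s k≢s) ⟩
    2 ^ m + 2 ^ m                     ≡⟨ cong (2 ^ m +_) (sym (ℕP.+-identityʳ (2 ^ m))) ⟩
    2 ^ suc m                         ∎
    where open ≡-Reasoning

commonOutputs-bound : ∀ (π σ : Vec (Fin (suc (suc m))) (suc (suc m))) →
  IsPerm π → IsPerm σ → σ ≢ π →
  (A : List (List (Fin (suc (suc m))))) → Unique A →
  (∀ τ → τ ∈ A → InSout τ π) → (∀ τ → τ ∈ A → InSout τ σ) → length A ≤ 2 ^ suc m
commonOutputs-bound π σ πinj σinj σ≢π A uniqueA fromπ fromσ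
  with k , differ , agree ← firstDifference σ π σ≢π
  with q , πq≡σk ← injective⇒onto πinj (lookup σ k)
     | s , σs≡πk ← injective⇒onto σinj (lookup π k) =
  commonOutputs-bound-at π σ πinj
    (occursAfter σ π σinj agree differ πq≡σk)
    (occursAfter π σ πinj (λ i i<k → sym (agree i i<k)) (differ ∘′ sym) σs≡πk)
    πq≡σk σs≡πk A uniqueA fromπ fromσ

corollary1 : (n : ℕ) → 3 ≤ n → (π : Vec (Fin n) n) → IsPerm π →
    (A : List (List (Fin n))) → Unique A → length A ≡ 2 ^ (n ∸ 1) + 1 →
    (∀ τ → τ ∈ A → InSout τ π) →
    (∀ τ → τ ∈ A → InSout τ π) ×
    ((σ : Vec (Fin n) n) → IsPerm σ → (∀ τ → τ ∈ A → InSout τ σ) → σ ≡ π)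
corollary1 (suc (suc (suc m))) (s≤s (s≤s (s≤s z≤n))) π πinj A uniqueA lengthA fromπ =
  fromπ , determined
  where
  determined : (σ : Vec (Fin (3 + m)) (3 + m)) → IsPerm σ → (∀ τ → τ ∈ A → InSout τ σ) → σ ≡ π
  determined σ σinj fromσ with VecP.≡-dec _≟_ σ π
  ... | yes σ≡π = σ≡π
  ... | no  σ≢π = contradiction
    (subst (_≤ 2 ^ (2 + m)) lengthA (commonOutputs-bound π σ πinj σinj σ≢π A uniqueA fromπ fromσ))
    (ℕP.m+1+n≰m (2 ^ (2 + m)))
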